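{- Let $S$ be a finite sphere-like poset of rank $k$ and $\mathcal{M}$ any acyclic matching on $S$. Let $\{x_1,\ldots,x_n\}$ be the set of elements $x$ of rank $k-1$ such that $(z,x)\in\mathcal{M}$ for some $z$. If $\sigma=\sum_{i=1}^n t_ix_i\in C_{k-1}$ ($t_i\in\mathbb{Z}_2$) satisfies $d_{k-1}(\sigma)=0$, then $\sigma=0$.
   Context: A ranked poset is a poset with rank function $\operatorname{rk}$ such that $x<y$ implies $\operatorname{rk}(x)<\operatorname{rk}(y)$ and $x\lessdot y$ ($y$ covers $x$) implies $\operatorname{rk}(y)=\operatorname{rk}(x)+1$; its rank is the maximum rank of an element. $\Delta(x)=\{z:z\lessdot x\}$. For $0\le q\le k$, $S_q$ is the set of elements of rank $q$, $C_q$ is the $\mathbb{Z}_2$-vector space with basis $S_q$, and $d_q:C_q\to C_{q-1}$ is the linear map with $d_q(x)=\sum_{z\in\Delta(x)}z$ for $x\in S_q$. A matching on $S$ is a set $\mathcal{M}$ of ordered pairs $(a,b)$ with $a\lessdot b$, each element in at most one pair. An $\mathcal{M}$-path is a sequence $y_0,x_1,y_1,\ldots,x_r,y_r$ ($r\ge0$) with $(x_i,y_i)\in\mathcal{M}$, $x_i\lessdot y_{i-1}$, $y_{i-1}\ne y_i$. $\mathcal{M}$ is acyclic if no $\mathcal{M}$-path has $r>0$ and $y_r=y_0$; an element is $\mathcal{M}$-critical if it lies in no pair. A ranked poset $S$ of rank $k\ge2$ is sphere-like if: (i) each element of rank $k-1$ is covered by exactly two elements; (ii) for each $y$ of rank $k$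 and $z$ of rank $k-2$, the number of $x$ of rank $k-1$ with $z\lessdot x\lessdot y$ is even; (iii) there exists an acyclic matching on $S$ such that no element of rank $k-1$ is critical for it. -}

module Defs where

open import Data.Nat using (ℕ; zero; suc; _∸_; _<_; _≤_)
open import Data.Nat using () renaming (_≟_ to _≟ℕ_)
open import Data.Nat.Divisibility using (_∣_)
open import Data.Fin using (Fin; _≟_)
open import Data.Fin.Properties using (all?)
open import Data.Bool using (Bool; true; false; _xor_; _∧_)
open import Data.List using (List; foldr; map; filter; length; allFin)
open import Data.Product using (Σ; ∃; _×_; _,_)
open import Data.Sum using (_⊎_)
open import Data.Empty using (⊥)
open import Relation.Nullary using (¬_; Dec; yes; no)
open import Relation.Nullary.Decidable using (⌊_⌋; ¬?; _×-dec_)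
open import Relation.Binary using (IsPartialOrder; Decidable)
open import Relation.Binary.PropositionalEquality using (_≡_; _≢_)

record FinPoset : Set₁ where
  field
    N     : ℕ
    _≼_   : Fin N → Fin N → Set
    isPO  : IsPartialOrder _≡_ _≼_
    _≼?_  : Decidable _≼_

  El : Set
  El = Fin N

  _≺_ : El → El → Set
  x ≺ y = (x ≼ y) × (x ≢ y)

  _≺?_ : Decidable _≺_
  x ≺? y = (x ≼? y) ×-dec ¬? (x ≟ y)

  _⋖_ : El → El → Set
  x ⋖ y = (x ≺ y) × (∀ z → ¬ ((x ≺ z) × (z ≺ y)))

  _⋖?_ : Decidable _⋖_
  x ⋖? y = (x ≺? y) ×-dec all? (λ z → ¬? ((x ≺? z) ×-dec (z ≺? y)))

  count : {P : El → Set} → ((x : El) → Dec (P x)) → ℕ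
  count P? = length (filter P? (allFin N))

  ⊕ : (El → Bool) → Bool
  ⊕ f = foldr _xor_ false (map f (allFin N))

open FinPoset public

record IsRanked (S : FinPoset) (rk : El S → ℕ) (k : ℕ) : Set where
  field
    strict   : ∀ x y → _≺_ S x y → rk x < rk y
    cover    : ∀ x y → _⋖_ S x y → rk y ≡ suc (rk x)
    bounded  : ∀ x → rk x ≤ k
    attained : ∃ λ x → rk x ≡ k

-- Chains: C_q is the Z₂-vector space with basis S_q; an element is
-- represented by its coefficient function, vanishing off rank q.
IsChain : (S : FinPoset) (rk : El S → ℕ) (q : ℕ) → (El S → Bool) → Set
IsChain S rk q c = ∀ x → c x ≡ true → rk x ≡ q

∂ : (S : FinPoset) → (El S → Bool) → (El S → Bool)
∂ S c z = ⊕ S (λ x → c x ∧ ⌊ _⋖?_ S z x ⌋)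

InPair : {A : Set} → A → A → A → Set
InPair e a b = (e ≡ a) ⊎ (e ≡ b)

record IsMatching (S : FinPoset) (M : El S → El S → Set) : Set where
  field
    covers : ∀ a b → M a b → _⋖_ S a b
    atMostOne : ∀ e a b a′ b′ → M a b → M a′ b′ →
                InPair e a b → InPair e a′ b′ → (a ≡ a′) × (b ≡ b′)

-- M-paths y₀, x₁, y₁, …, x_r, y_r  from y₀ to y_r of length r
data MPath (S : FinPoset) (M : El S → El S → Set) : El S → El S → ℕ → Set where
  stop : ∀ y → MPath S M y y zero
  step : ∀ {y₀ x₁ y₁ yr r} → _⋖_ S x₁ y₀ → M x₁ y₁ → y₀ ≢ y₁ →
         MPath S M y₁ yr r → MPath S M y₀ yr (suc r)

IsAcyclic : (S : FinPoset) (M : El S → El S → Set) → Set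
IsAcyclic S M = ∀ y r → MPath S M y y (suc r) → ⊥

IsAcyclicMatching : (S : FinPoset) (M : El S → El S → Set) → Set
IsAcyclicMatching S M = IsMatching S M × IsAcyclic S M

Critical : (S : FinPoset) (M : El S → El S → Set) → El S → Set
Critical S M x = ∀ a b → M a b → ¬ InPair x a b

record SphereLike (S : FinPoset) (rk : El S → ℕ) (k : ℕ) : Set₁ where
  field
    ranked : IsRanked S rk k
    k≥2    : 2 ≤ k
    twoCovers : ∀ x → rk x ≡ k ∸ 1 →
      Σ (El S) λ y₁ → Σ (El S) λ y₂ → (y₁ ≢ y₂) × _⋖_ S x y₁ × _⋖_ S x y₂ ×
        (∀ y → _⋖_ S x y → (y ≡ y₁) ⊎ (y ≡ y₂))
    diamond : ∀ y z → rk y ≡ k → rk z ≡ k ∸ 2 →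
      2 ∣ count S (λ x → (rk x ≟ℕ (k ∸ 1)) ×-dec (_⋖?_ S z x ×-dec _⋖?_ S x y))
    goodMatching : Σ (El S → El S → Set) λ M′ → IsAcyclicMatching S M′ ×
      (∀ x → rk x ≡ k ∸ 1 → ¬ Critical S M′ x)

{-# OPTIONS --safe #-}
module Submission where

-- Every x in the support of σ is matched with some z ⋖ x. As d σ = 0, the
-- coefficient of z in d σ vanishes, so z is covered by a second element x′ of
-- the support, and x′ , z , x is an M-path. Hence every element of the support
-- has an M-predecessor in the support; following predecessors inside the finite
-- poset must revisit an element, producing a closed M-path, which acyclicity
-- forbids. Neither the sphere-like structure nor the ranks enter the argument.

open import Defs
open import Data.Nat using (ℕ; _∸_; zero; suc; _+_)
open import Data.Nat.Properties using (n<1+n; m≤n⇒∃[o]m+o≡n; +-comm)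
open import Data.Bool using (Bool; true; false; _xor_; _∧_) renaming (_≟_ to _≟ᵇ_)
open import Data.Bool.Properties using (xor-identityʳ; ∧-conicalˡ; ∧-conicalʳ; ¬-not; T-≡)
open import Data.Fin using (Fin; toℕ; _≟_) renaming (zero to fzero; suc to fsuc)
open import Data.Fin.Properties using (any?; pigeonhole; suc-injective)
open import Data.List using (foldr; tabulate)
open import Data.List.Properties using (map-tabulate)
open import Data.Product using (Σ; ∃; ∃₂; _×_; _,_; proj₁; proj₂)
open import Function using (id; _∘_; Equivalence)
open import Relation.Nullary using (¬_; yes; no; contradiction)
open import Relation.Nullary.Decidable using (⌊_⌋; toWitness; fromWitness; ¬?; _×-dec_)
open import Relation.Binary.PropositionalEquality

xor-tabulate-false : ∀ {n} (g : Fin n → Bool) → (∀ x → g x ≡ false) →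
                     foldr _xor_ false (tabulate g) ≡ false
xor-tabulate-false {zero}  g g≡false = refl
xor-tabulate-false {suc n} g g≡false rewrite g≡false fzero =
  xor-tabulate-false (g ∘ fsuc) (g≡false ∘ fsuc)

xor-tabulate-single : ∀ {n} (g : Fin n → Bool) (y : Fin n) →
                      (∀ x → x ≢ y → g x ≡ false) →
                      foldr _xor_ false (tabulate g) ≡ g y
xor-tabulate-single {suc n} g fzero g≡false
  rewrite xor-tabulate-false (g ∘ fsuc) (λ x → g≡false (fsuc x) λ ())
  = xor-identityʳ (g fzero)
xor-tabulate-single {suc n} g (fsuc y) g≡false rewrite g≡false fzero λ () =
  xor-tabulate-single (g ∘ fsuc) y (λ x x≢y → g≡false (fsuc x) (x≢y ∘ suc-injective))

⊕-single : (S : FinPoset) (g : El S → Bool) (y : El S) →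
           (∀ x → x ≢ y → g x ≡ false) → ⊕ S g ≡ g y
⊕-single S g y g≡false = begin
  ⊕ S g                          ≡⟨ cong (foldr _xor_ false) (map-tabulate id g) ⟩
  foldr _xor_ false (tabulate g) ≡⟨ xor-tabulate-single g y g≡false ⟩
  g y                            ∎
  where open ≡-Reasoning

⊕≡false⇒another : (S : FinPoset) (g : El S → Bool) (y : El S) →
                  g y ≡ true → ⊕ S g ≡ false → ∃ λ x → x ≢ y × g x ≡ true
⊕≡false⇒another S g y gy≡true ⊕g≡false
  with any? (λ x → ¬? (x ≟ y) ×-dec (g x ≟ᵇ true))
... | yes another = another
... | no  ¬another = contradiction true≡false λ ()
  where
  g≡false : ∀ x → x ≢ y → g x ≡ false
  g≡false x x≢y = ¬-not λ gx≡true → ¬another (x , x≢y , gx≡true)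

  true≡false : true ≡ false
  true≡false = begin
    true  ≡⟨ sym gy≡true ⟩
    g y   ≡⟨ sym (⊕-single S g y g≡false) ⟩
    ⊕ S g ≡⟨ ⊕g≡false ⟩
    false ∎
    where open ≡-Reasoning

ℕ→Fin-revisits : ∀ {n} (f : ℕ → Fin n) → ∃₂ λ i d → f (suc d + i) ≡ f i
ℕ→Fin-revisits {n} f with pigeonhole (n<1+n n) (f ∘ toℕ)
... | i , j , i<j , fi≡fj with m≤n⇒∃[o]m+o≡n i<j
...   | d , 1+i+d≡j = toℕ i , d , trans (cong f 1+d+i≡j) (sym fi≡fj)
  where
  1+d+i≡j : suc d + toℕ i ≡ toℕ j
  1+d+i≡j = trans (cong suc (+-comm d (toℕ i))) 1+i+d≡j

PredecessorClosed : (S : FinPoset) (M : El S → El S → Set) (P : El S → Set) → Set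
PredecessorClosed S M P = ∀ y → P y → Σ (El S) λ y′ → P y′ × MPath S M y′ y 1

MPath-extend : ∀ {S M y₀ y₁ y r} → MPath S M y₀ y₁ 1 → MPath S M y₁ y r →
               MPath S M y₀ y (suc r)
MPath-extend (step x⋖y₀ Mxy₁ y₀≢y₁ (stop _)) p = step x⋖y₀ Mxy₁ y₀≢y₁ p

acyclic⇒predecessorClosed-empty : (S : FinPoset) (M : El S → El S → Set) →
  IsAcyclic S M → (P : El S → Set) → PredecessorClosed S M P → ∀ x → ¬ P x
acyclic⇒predecessorClosed-empty S M acyclic P closed x Px =
  let (i , d , revisit) = ℕ→Fin-revisits walk in
  acyclic (walk i) d (subst (λ y → MPath S M y (walk i) (suc d)) revisit (walk-path (suc d) i))
  where
  predecessor : Σ (El S) P → Σ (El S) P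
  predecessor (y , Py) = let (y′ , Py′ , _) = closed y Py in y′ , Py′

  point : ℕ → Σ (El S) P
  point zero    = x , Px
  point (suc n) = predecessor (point n)

  walk : ℕ → El S
  walk = proj₁ ∘ point

  walk-path : ∀ m n → MPath S M (walk (m + n)) (walk n) m
  walk-path zero    n = stop (walk n)
  walk-path (suc m) n =
    let (y , Py) = point (m + n); (_ , _ , y′→y) = closed y Py in
    MPath-extend y′→y (walk-path m n)

cycle-support-predecessorClosed : (S : FinPoset) (M : El S → El S → Set) →
  (∀ a b → M a b → _⋖_ S a b) → (σ : El S → Bool) → (∀ z → ∂ S σ z ≡ false) →
  (∀ y → σ y ≡ true → ∃ λ z → M z y) →
  PredecessorClosed S M (λ y → σ y ≡ true)
cycle-support-predecessorClosed S M covers σ closed matched y σy≡true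
  with matched y σy≡true
... | z , Mzy with ⊕≡false⇒another S (λ x → σ x ∧ ⌊ _⋖?_ S z x ⌋) y
                     (cong₂ _∧_ σy≡true (Equivalence.to T-≡ (fromWitness (covers z y Mzy))))
                     (closed z)
...   | y′ , y′≢y , coefficient =
  y′ , ∧-conicalˡ _ _ coefficient , step z⋖y′ Mzy y′≢y (stop y)
  where
  z⋖y′ : _⋖_ S z y′
  z⋖y′ = toWitness {a? = _⋖?_ S z y′} (Equivalence.from T-≡ (∧-conicalʳ (σ y′) _ coefficient))

lemma3p2 : (S : FinPoset) (rk : El S → ℕ) (k : ℕ) → SphereLike S rk k →
    (M : El S → El S → Set) → IsAcyclicMatching S M →
    (σ : El S → Bool) →
    (∀ x → σ x ≡ true → (rk x ≡ k ∸ 1) × ∃ λ z → M z x) →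
    (∀ z → ∂ S σ z ≡ false) →
    ∀ x → σ x ≡ false
lemma3p2 S rk k _ M (matching , acyclic) σ supported closed x =
  ¬-not (acyclic⇒predecessorClosed-empty S M acyclic (λ y → σ y ≡ true)
          (cycle-support-predecessorClosed S M (IsMatching.covers matching) σ closed
             (λ y σy≡true → proj₂ (supported y σy≡true)))
          x)
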